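{- Let $q^\bot$ be a fixed propositional variable, and extend the translation $*$ (defined on Łukasiewicz formulas by $p^*=(p\lor q^\bot)\land t$, $\bot^*=q^\bot\land t$, $(A\Rightarrow B)^*=t\land(A^*\to B^*)$) to multisets elementwise, to sequents by $(\Gamma\vdash\Delta)^*=\Gamma^*\vdash\Delta^*$ and to hypersequents by $(S_1\mid\ldots\mid S_n)^*=S_1^*\mid\ldots\mid S_n^*$. Then for every hypersequent $G$ of Łukasiewicz formulas in which $q^\bot$ does not occur, $\models^*_{Ł} G$ if and only if $\models_{\mathbf{A}} G^*$.
   Context: Łukasiewicz formulas are built from propositional variables and $\bot$ using $\Rightarrow$. A sequent is a pair of finite multisets of formulas, a hypersequent a finite multiset of sequents $\Gamma_1\vdash\Delta_1\mid\ldots\mid\Gamma_n\vdash\Delta_n$. $\models^*_{Ł}G$ means: for every valuation $v$ into $[-1,0]$ with $v(\bot)=-1$, $v(A\Rightarrow B)=\min(0,v(B)-v(A))$, there is $i$ with $\sum_{A\in\Gamma_i}v(A)\le\sum_{B\in\Delta_i}v(B)$ (ordinary real sums; empty sum $0$). Formulas of abelian logic are built from propositional variables and $t$ using $+,\to,\land,\lor,\lnot$; $\models_{\mathbf{A}}H$ for a hypersequent $H$ means: for every valuation into $\mathbb{Q}$ ($t=0$, $+$ addition, $\lnot$ negation, $A\to B$ valued $v(B)-v(A)$, $\land=\min$, $\lor=\max$) some component $\Gamma_i\vdash\Delta_i$ of $H$ has $\sum v(\Gamma_i)\le\sum v(\Delta_i)$.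
   Formalization: The Łukasiewicz valuations in $\models^*_{Ł}$ take values in the rational points of $[-1,0]$ rather than the real interval. -}

module Defs where

open import Data.Nat using (ℕ)
open import Data.Rational using (ℚ; 0ℚ; 1ℚ; _+_; _-_; -_; _⊓_; _⊔_; _≤_)
open import Data.List using (List; []; _∷_; map; foldr)
open import Data.List.Relation.Unary.Any using (Any)
open import Data.List.Relation.Unary.All using (All)
open import Data.Product using (_×_; _,_; proj₁; proj₂)
open import Relation.Binary.PropositionalEquality using (_≡_)
open import Relation.Nullary using (¬_)
open import Data.Empty using (⊥)
open import Data.Sum using (_⊎_)

Var : Set
Var = ℕ

-- Multisets, sequents, hypersequents (multisets represented by lists;
-- all notions below are invariant under permutation).
Sequent : Set → Set
Sequent F = List F × List F

Hypersequent : Set → Set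
Hypersequent F = List (Sequent F)

sumℚ : List ℚ → ℚ
sumℚ = foldr _+_ 0ℚ

holdsSeq : {F : Set} → (F → ℚ) → Sequent F → Set
holdsSeq e (Γ , Δ) = sumℚ (map e Γ) ≤ sumℚ (map e Δ)

data LFormula : Set where
  lvar : Var → LFormula
  l⊥   : LFormula
  _⇒_  : LFormula → LFormula → LFormula

-- evaluation into [-1,0]
evalŁ : (Var → ℚ) → LFormula → ℚ
evalŁ v (lvar p) = v p
evalŁ v l⊥ = - 1ℚ
evalŁ v (A ⇒ B) = 0ℚ ⊓ (evalŁ v B - evalŁ v A)

ŁValuation : (Var → ℚ) → Set
ŁValuation v = ∀ p → (- 1ℚ ≤ v p) × (v p ≤ 0ℚ)

⊨Ł : Hypersequent LFormula → Set
⊨Ł G = ∀ (v : Var → ℚ) → ŁValuation v → Any (holdsSeq (evalŁ v)) G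

data AFormula : Set where
  avar : Var → AFormula
  t    : AFormula
  _⊕_  : AFormula → AFormula → AFormula
  _⟶_  : AFormula → AFormula → AFormula
  _∧_  : AFormula → AFormula → AFormula
  _∨_  : AFormula → AFormula → AFormula
  ¬ₐ_  : AFormula → AFormula

evalA : (Var → ℚ) → AFormula → ℚ
evalA v (avar p) = v p
evalA v t = 0ℚ
evalA v (A ⊕ B) = evalA v A + evalA v B
evalA v (A ⟶ B) = evalA v B - evalA v A
evalA v (A ∧ B) = evalA v A ⊓ evalA v B
evalA v (A ∨ B) = evalA v A ⊔ evalA v B
evalA v (¬ₐ A) = - evalA v A

⊨A : Hypersequent AFormula → Set
⊨A H = ∀ (v : Var → ℚ) → Any (holdsSeq (evalA v)) H

trans : Var → LFormula → AFormula
trans q (lvar p) = (avar p ∨ avar q) ∧ t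
trans q l⊥ = avar q ∧ t
trans q (A ⇒ B) = t ∧ (trans q A ⟶ trans q B)

transSeq : Var → Sequent LFormula → Sequent AFormula
transSeq q (Γ , Δ) = map (trans q) Γ , map (trans q) Δ

transHyp : Var → Hypersequent LFormula → Hypersequent AFormula
transHyp q = map (transSeq q)

occurs : Var → LFormula → Set
occurs q (lvar p) = p ≡ q
occurs q l⊥ = ⊥
occurs q (A ⇒ B) = occurs q A ⊎ occurs q B

notOccursHyp : Var → Hypersequent LFormula → Set
notOccursHyp q G = All (λ S → All (λ A → ¬ occurs q A) (proj₁ S) × All (λ A → ¬ occurs q A) (proj₂ S)) G

{-# OPTIONS --safe #-}
module Submission where

-- If q does not occur in A, then under any Łukasiewicz valuation v extended by
-- q ↦ -1 the translation A* takes exactly the value of A, since q plays the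
-- role of -1, t that of 0 and "∧ t" truncates into [-1,0]; so ⊨A G* gives ⊨Ł G.
-- Conversely, let w be any rational valuation and c = w(q). If c < 0, then
-- v(p) = w(p*)/|c| is a Łukasiewicz valuation with v(A) = w(A*)/|c| for every A,
-- and dividing by |c| > 0 preserves every sequent inequality. If c ≥ 0, every
-- A* takes the value 0, so every component of G* holds.

open import Defs
open import Algebra.Properties.Group using (⁻¹-involutive)
open import Data.Nat as ℕ using ()
open import Data.Rational
  using (ℚ; 0ℚ; 1ℚ; _+_; _-_; -_; _*_; 1/_; _⊓_; _⊔_; _≤_; _<_; _≤?_;
         Positive; NonNegative; NonZero; positive)
open import Data.Rational.Properties
open import Data.List using (List; []; _∷_; map)
open import Data.List.Properties using (map-∘; map-cong; map-cong-local)
open import Data.List.Relation.Unary.All as All using (All)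
open import Data.List.Relation.Unary.Any as Any using (Any)
open import Data.List.Relation.Unary.Any.Properties using (map⁺; map⁻)
open import Data.List.Membership.Propositional using (_∈_; find; lose)
open import Data.Product using (_×_; _,_; ∃-syntax; proj₁; proj₂)
open import Data.Sum using (inj₁; inj₂)
open import Data.Empty using (⊥-elim)
open import Function using (_∘_; id)
open import Function.Bundles using (_⇔_; mk⇔; Equivalence)
open import Relation.Nullary using (¬_; Dec; yes; no)
open import Relation.Binary.PropositionalEquality
  using (_≡_; refl; sym; cong; cong₂; subst; subst₂; module ≡-Reasoning)
  renaming (trans to ≡-trans)

-1≤0 : - 1ℚ ≤ 0ℚ
-1≤0 = nonPositive⁻¹ (- 1ℚ)

sumℚ-map-*ʳ : {F : Set} (f : F → ℚ) (r : ℚ) (xs : List F) →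
              sumℚ (map (λ x → f x * r) xs) ≡ sumℚ (map f xs) * r
sumℚ-map-*ʳ f r []       = sym (*-zeroˡ r)
sumℚ-map-*ʳ f r (x ∷ xs) = begin
  f x * r + sumℚ (map (λ x → f x * r) xs) ≡⟨ cong (f x * r +_) (sumℚ-map-*ʳ f r xs) ⟩
  f x * r + sumℚ (map f xs) * r           ≡⟨ sym (*-distribʳ-+ r (f x) (sumℚ (map f xs))) ⟩
  (f x + sumℚ (map f xs)) * r             ∎
  where open ≡-Reasoning

sumℚ-map-zero : {F : Set} {f : F → ℚ} → (∀ x → f x ≡ 0ℚ) → (xs : List F) →
                sumℚ (map f xs) ≡ 0ℚ
sumℚ-map-zero f≡0 []       = refl
sumℚ-map-zero f≡0 (x ∷ xs) = cong₂ _+_ (f≡0 x) (sumℚ-map-zero f≡0 xs)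

module _ {F : Set} where

  holdsSeq-zero : {e : F → ℚ} → (∀ A → e A ≡ 0ℚ) → (S : Sequent F) → holdsSeq e S
  holdsSeq-zero e≡0 (Γ , Δ) =
    subst₂ _≤_ (sym (sumℚ-map-zero e≡0 Γ)) (sym (sumℚ-map-zero e≡0 Δ)) ≤-refl

  holdsSeq-cong-local : {e e′ : F → ℚ} {Γ Δ : List F} →
                        All (λ A → e A ≡ e′ A) Γ → All (λ A → e A ≡ e′ A) Δ →
                        holdsSeq e (Γ , Δ) → holdsSeq e′ (Γ , Δ)
  holdsSeq-cong-local eqΓ eqΔ =
    subst₂ _≤_ (cong sumℚ (map-cong-local eqΓ)) (cong sumℚ (map-cong-local eqΔ))

  holdsSeq-cancel-pos : {e e′ : F → ℚ} (r : ℚ) .{{_ : Positive r}} →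
                        (∀ A → e A ≡ e′ A * r) → (S : Sequent F) →
                        holdsSeq e S → holdsSeq e′ S
  holdsSeq-cancel-pos {e} {e′} r e≡e′*r (Γ , Δ) h =
    *-cancelʳ-≤-pos r (subst₂ _≤_ (scale Γ) (scale Δ) h)
    where
    scale : ∀ Γ → sumℚ (map e Γ) ≡ sumℚ (map e′ Γ) * r
    scale Γ = ≡-trans (cong sumℚ (map-cong e≡e′*r Γ)) (sumℚ-map-*ʳ e′ r Γ)

holdsSeq-transSeq : (e : AFormula → ℚ) (q : Var) (S : Sequent LFormula) →
                    holdsSeq e (transSeq q S) ≡ holdsSeq (e ∘ trans q) S
holdsSeq-transSeq e q (Γ , Δ) =
  cong₂ _≤_ (cong sumℚ (sym (map-∘ Γ))) (cong sumℚ (sym (map-∘ Δ)))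

Any-holdsSeq-transHyp : (e : AFormula → ℚ) (q : Var) (G : Hypersequent LFormula) →
                        Any (holdsSeq e) (transHyp q G) ⇔ Any (holdsSeq (e ∘ trans q)) G
Any-holdsSeq-transHyp e q G = mk⇔
  (Any.map (λ {S} → subst id (holdsSeq-transSeq e q S)) ∘ map⁻)
  (map⁺ ∘ Any.map (λ {S} → subst id (sym (holdsSeq-transSeq e q S))))

_[_↦_] : (Var → ℚ) → Var → ℚ → Var → ℚ
(v [ q ↦ c ]) p with p ℕ.≟ q
... | yes _ = c
... | no  _ = v p

[↦]-≡ : (v : Var → ℚ) (q : Var) (c : ℚ) → (v [ q ↦ c ]) q ≡ c
[↦]-≡ v q c with q ℕ.≟ q
... | yes _   = refl
... | no  q≢q = ⊥-elim (q≢q refl)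

[↦]-≢ : (v : Var → ℚ) {q p : Var} (c : ℚ) → ¬ p ≡ q → (v [ q ↦ c ]) p ≡ v p
[↦]-≢ v {q} {p} c p≢q with p ℕ.≟ q
... | yes p≡q = ⊥-elim (p≢q p≡q)
... | no  _   = refl

evalA-trans-[↦-1] : {v : Var → ℚ} → ŁValuation v →
                    {q : Var} (A : LFormula) → ¬ occurs q A →
                    evalA (v [ q ↦ - 1ℚ ]) (trans q A) ≡ evalŁ v A
evalA-trans-[↦-1] {v} hv {q} (lvar p) p≢q = begin
  (w p ⊔ w q) ⊓ 0ℚ   ≡⟨ cong₂ (λ x y → (x ⊔ y) ⊓ 0ℚ)
                              ([↦]-≢ v (- 1ℚ) p≢q) ([↦]-≡ v q (- 1ℚ)) ⟩
  (v p ⊔ - 1ℚ) ⊓ 0ℚ  ≡⟨ cong (_⊓ 0ℚ) (p≥q⇒p⊔q≡p (proj₁ (hv p))) ⟩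
  v p ⊓ 0ℚ           ≡⟨ p≤q⇒p⊓q≡p (proj₂ (hv p)) ⟩
  v p                ∎
  where
  open ≡-Reasoning
  w = v [ q ↦ - 1ℚ ]
evalA-trans-[↦-1] {v} hv {q} l⊥ _ = begin
  (v [ q ↦ - 1ℚ ]) q ⊓ 0ℚ ≡⟨ cong (_⊓ 0ℚ) ([↦]-≡ v q (- 1ℚ)) ⟩
  - 1ℚ ⊓ 0ℚ               ≡⟨ p≤q⇒p⊓q≡p -1≤0 ⟩
  - 1ℚ                    ∎
  where open ≡-Reasoning
evalA-trans-[↦-1] hv (A ⇒ B) q∉A⇒B = cong₂ (λ a b → 0ℚ ⊓ (b - a))
  (evalA-trans-[↦-1] hv A (q∉A⇒B ∘ inj₁)) (evalA-trans-[↦-1] hv B (q∉A⇒B ∘ inj₂))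

⊨A-trans⇒⊨Ł : (q : Var) (G : Hypersequent LFormula) → notOccursHyp q G →
              ⊨A (transHyp q G) → ⊨Ł G
⊨A-trans⇒⊨Ł q G q∉G ⊨G* v hv =
  pull (find (Equivalence.to (Any-holdsSeq-transHyp (evalA w) q G) (⊨G* w)))
  where
  w = v [ q ↦ - 1ℚ ]
  pull : ∃[ S ] S ∈ G × holdsSeq (evalA w ∘ trans q) S → Any (holdsSeq (evalŁ v)) G
  pull ((Γ , Δ) , S∈G , holds) with q∉Γ , q∉Δ ← All.lookup q∉G S∈G =
    lose S∈G (holdsSeq-cong-local (All.map (evalA-trans-[↦-1] hv _) q∉Γ)
                                  (All.map (evalA-trans-[↦-1] hv _) q∉Δ) holds)

evalA-trans-nonneg : {w : Var → ℚ} {q : Var} → 0ℚ ≤ w q →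
                     (A : LFormula) → evalA w (trans q A) ≡ 0ℚ
evalA-trans-nonneg {w} {q} 0≤wq (lvar p) = p≥q⇒p⊓q≡q (≤-trans 0≤wq (p≤q⊔p (w p) (w q)))
evalA-trans-nonneg 0≤wq l⊥ = p≥q⇒p⊓q≡q 0≤wq
evalA-trans-nonneg 0≤wq (A ⇒ B) =
  cong₂ (λ a b → 0ℚ ⊓ (b - a)) (evalA-trans-nonneg 0≤wq A) (evalA-trans-nonneg 0≤wq B)

module Rescaled (w : Var → ℚ) (q : Var) (wq<0 : w q < 0ℚ) where

  instance
    -wq-pos : Positive (- w q)
    -wq-pos = positive (neg-antimono-< wq<0)

    -wq-nonZero : NonZero (- w q)
    -wq-nonZero = pos⇒nonZero (- w q)

  r : ℚ
  r = 1/ (- w q)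

  instance
    r-pos : Positive r
    r-pos = 1/pos⇒pos (- w q)

    r-nonNeg : NonNegative r
    r-nonNeg = pos⇒nonNeg r

  wq*r≡-1 : w q * r ≡ - 1ℚ
  wq*r≡-1 = begin
    w q * r          ≡⟨ cong (_* r) (sym (⁻¹-involutive +-0-group (w q))) ⟩
    - (- w q) * r    ≡⟨ sym (neg-distribˡ-* (- w q) r) ⟩
    - (- w q * r)    ≡⟨ cong -_ (*-inverseʳ (- w q)) ⟩
    - 1ℚ             ∎
    where open ≡-Reasoning

  v : Var → ℚ
  v p = evalA w (trans q (lvar p)) * r

  v-ŁValuation : ŁValuation v
  v-ŁValuation p =
    subst (_≤ v p) wq*r≡-1 (*-monoʳ-≤-nonNeg r (⊓-glb (p≤q⊔p (w p) (w q)) (<⇒≤ wq<0))) ,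
    subst (v p ≤_) (*-zeroˡ r) (*-monoʳ-≤-nonNeg r (p⊓q≤q (w p ⊔ w q) 0ℚ))

  evalŁ-v : (A : LFormula) → evalŁ v A ≡ evalA w (trans q A) * r
  evalŁ-v (lvar p) = refl
  evalŁ-v l⊥ = begin
    - 1ℚ             ≡⟨ sym wq*r≡-1 ⟩
    w q * r          ≡⟨ cong (_* r) (sym (p≤q⇒p⊓q≡p (<⇒≤ wq<0))) ⟩
    (w q ⊓ 0ℚ) * r   ∎
    where open ≡-Reasoning
  evalŁ-v (A ⇒ B) = begin
    0ℚ ⊓ (evalŁ v B - evalŁ v A)  ≡⟨ cong₂ (λ a b → 0ℚ ⊓ (b - a)) (evalŁ-v A) (evalŁ-v B) ⟩
    0ℚ ⊓ (b * r - a * r)          ≡⟨ cong (λ x → 0ℚ ⊓ (b * r + x)) (neg-distribˡ-* a r) ⟩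
    0ℚ ⊓ (b * r + - a * r)        ≡⟨ cong (0ℚ ⊓_) (sym (*-distribʳ-+ r b (- a))) ⟩
    0ℚ ⊓ ((b - a) * r)            ≡⟨ cong (_⊓ ((b - a) * r)) (sym (*-zeroˡ r)) ⟩
    (0ℚ * r) ⊓ ((b - a) * r)      ≡⟨ sym (*-distribʳ-⊓-nonNeg r 0ℚ (b - a)) ⟩
    (0ℚ ⊓ (b - a)) * r            ∎
    where
    open ≡-Reasoning
    a = evalA w (trans q A)
    b = evalA w (trans q B)

⊨Ł⇒⊨A-trans : (q : Var) (G : Hypersequent LFormula) → ⊨Ł G → ⊨A (transHyp q G)
⊨Ł⇒⊨A-trans q G ⊨G w =
  Equivalence.from (Any-holdsSeq-transHyp (evalA w) q G) (holds (0ℚ ≤? w q))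
  where
  holds : Dec (0ℚ ≤ w q) → Any (holdsSeq (evalA w ∘ trans q)) G
  -- ⊨Ł G at the constant valuation 0 only serves to show that G is nonempty.
  holds (yes 0≤wq) = Any.map (λ {S} _ → holdsSeq-zero (evalA-trans-nonneg 0≤wq) S)
                             (⊨G (λ _ → 0ℚ) (λ _ → -1≤0 , ≤-refl))
  holds (no 0≰wq)  = Any.map (λ {S} → holdsSeq-cancel-pos r evalŁ-v S) (⊨G v v-ŁValuation)
    where open Rescaled w q (≰⇒> 0≰wq)

mainTheorem6 : (q : Var) (G : Hypersequent LFormula) → notOccursHyp q G →
    (⊨Ł G ⇔ ⊨A (transHyp q G))
mainTheorem6 q G q∉G = mk⇔ (⊨Ł⇒⊨A-trans q G) (⊨A-trans⇒⊨Ł q G q∉G)
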